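{- Let $\Gamma=(D,A,B)$ be a web (satisfying the standing assumptions below). Any wave that is maximal with respect to forward extension (and hence any wave that is maximal with respect to extension) is $\le$-maximal. Moreover, if $\mathcal V$ is a $\le$-maximal wave, then there does not exist a trimmed wave $\mathcal W$ such that $\mathcal E(\mathcal V)\preccurlyeq\mathcal W$ and $\mathcal E(\mathcal V)\ne\mathcal W$.
   Context: A web is $\Gamma=(D,A,B)$, $D$ a digraph, $A,B\subseteq V(D)$. Standing assumptions: no edge has head in $A$ or tail in $B$; every vertex of $A$ can reach $B$. Paths are simple directed paths with initial vertex $in(P)$, finite (terminal vertex $ter(P)$) or one-way infinite; single vertices are paths. A warp is a set of pairwise vertex-disjoint paths; $V[\mathcal W]$, $E[\mathcal W]$ are the unions of vertex/edge sets, $in[\mathcal W]$ the initial vertices, $ter[\mathcal W]$ the terminal vertices of finite paths. A wave is a warp $\mathcal W$ with $in[\mathcal W]\subseteq A$ such that every finite path from $A$ to $B$ meets $ter[\mathcal W]$. For $S\subseteq V(D)$: $RF(S)$ is the set of vertices $v$ such that every path from $v$ to $B$ meets $S$; $\mathcal E(S)$ is the set of $s\in S$ from which some path to $B$ meets $S$ only in $s$. For a warp $\mathcal W$, $\mathcal E(\mathcal W)$ is the set of finite paths $P\in\mathcal W$ with $ter(P)\in\mathcal E(ter[\mathcal W])$; $\mathcal W$ is trimmed if $\mathcal W=\mathcal E(\mathcal W)$. $\mathcal W\preccurlyeq\mathcal U$ ($\mathcal U$ extends $\mathcal W$) means $V[\mathcal W]\subseteq V[\mathcal U]$ and $E[\mathcal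 W]\subseteq E[\mathcal U]$; a forward extension additionally requires $in[\mathcal W]=in[\mathcal U]$. A wave is maximal with respect to (forward) extension if no other wave (forward) extends it. A wave $\mathcal V$ is $\le$-maximal if there is no wave $\mathcal U$ with $RF(ter[\mathcal V])\subsetneq RF(ter[\mathcal U])$. -}

module Defs where

open import Level using (0ℓ)
open import Data.Nat using (ℕ; suc)
open import Data.List using (List; []; _∷_)
open import Data.List.Membership.Propositional using (_∈_)
open import Data.List.Relation.Unary.Linked using (Linked)
open import Data.List.Relation.Unary.Unique.Propositional using (Unique)
open import Data.Product using (Σ; ∃; _×_; _,_)
open import Data.Empty using (⊥)
open import Data.Unit using (⊤)
open import Relation.Nullary using (¬_)
open import Relation.Unary using (Pred; _⊆_)
open import Relation.Binary.PropositionalEquality using (_≡_)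
open import Function.Definitions using (Injective)

-- A digraph is given by a vertex type V and an edge relation E
-- (E u v : there is an edge with tail u and head v).
module Web {V : Set} (E : V → V → Set) (A B : Pred V 0ℓ) where

  data RawPath : Set where
    fin : V → List V → RawPath
    inf : (ℕ → V) → RawPath

  IsPath : RawPath → Set
  IsPath (fin x xs) = Unique (x ∷ xs) × Linked E (x ∷ xs)
  IsPath (inf f)    = Injective _≡_ _≡_ f × (∀ n → E (f n) (f (suc n)))

  _≈ₚ_ : RawPath → RawPath → Set
  fin x xs ≈ₚ fin y ys = x ≡ y × xs ≡ ys
  inf f    ≈ₚ inf g    = ∀ n → f n ≡ g n
  _        ≈ₚ _        = ⊥

  IsFinite : RawPath → Set
  IsFinite (fin _ _) = ⊤
  IsFinite (inf _)   = ⊥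

  lastV : V → List V → V
  lastV x []       = x
  lastV x (y ∷ ys) = lastV y ys

  inP : RawPath → V
  inP (fin x _) = x
  inP (inf f)   = f 0

  TerIs : RawPath → V → Set
  TerIs (fin x xs) v = lastV x xs ≡ v
  TerIs (inf _)    v = ⊥

  VOf : RawPath → Pred V 0ℓ
  VOf (fin x xs) v = v ∈ (x ∷ xs)
  VOf (inf f)    v = ∃ λ n → f n ≡ v

  data Consec (u v : V) : List V → Set where
    here  : ∀ {xs} → Consec u v (u ∷ v ∷ xs)
    there : ∀ {z xs} → Consec u v xs → Consec u v (z ∷ xs)

  EOf : RawPath → V → V → Set
  EOf (fin x xs) u v = Consec u v (x ∷ xs)
  EOf (inf f)    u v = ∃ λ n → f n ≡ u × f (suc n) ≡ v

  PathToB : V → RawPath → Set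
  PathToB v P = IsPath P × inP P ≡ v × ∃ λ b → TerIs P b × B b

  PathAB : RawPath → Set
  PathAB P = IsPath P × A (inP P) × ∃ λ b → TerIs P b × B b

  Meets : RawPath → Pred V 0ℓ → Set
  Meets P S = ∃ λ u → VOf P u × S u

  record StandingAssumptions : Set where
    field
      noHeadInA : ∀ u v → E u v → ¬ A v
      noTailInB : ∀ u v → E u v → ¬ B u
      AreachesB : ∀ a → A a → ∃ λ P → PathToB a P

  RF : Pred V 0ℓ → Pred V 0ℓ
  RF S v = ∀ P → PathToB v P → Meets P S

  Ess : Pred V 0ℓ → Pred V 0ℓ
  Ess S s = S s × ∃ λ P → PathToB s P × (∀ u → VOf P u → S u → u ≡ s)

  PathSet : Set₁
  PathSet = Pred RawPath 0ℓ

  _≐_ : PathSet → PathSet → Set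
  W ≐ U = (∀ P → W P → ∃ λ Q → U Q × P ≈ₚ Q) × (∀ Q → U Q → ∃ λ P → W P × P ≈ₚ Q)

  IsWarp : PathSet → Set
  IsWarp W = (∀ P → W P → IsPath P)
           × (∀ P Q → W P → W Q → ∀ v → VOf P v → VOf Q v → P ≈ₚ Q)

  V[_] : PathSet → Pred V 0ℓ
  V[ W ] v = ∃ λ P → W P × VOf P v

  E[_] : PathSet → V → V → Set
  E[ W ] u v = ∃ λ P → W P × EOf P u v

  in[_] : PathSet → Pred V 0ℓ
  in[ W ] v = ∃ λ P → W P × inP P ≡ v

  ter[_] : PathSet → Pred V 0ℓ
  ter[ W ] v = ∃ λ P → W P × TerIs P v

  IsWave : PathSet → Set
  IsWave W = IsWarp W × in[ W ] ⊆ A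
           × (∀ P → PathAB P → Meets P ter[ W ])

  EssW : PathSet → PathSet
  EssW W P = W P × ∃ λ t → TerIs P t × Ess ter[ W ] t

  Trimmed : PathSet → Set
  Trimmed W = W ≐ EssW W

  _≼_ : PathSet → PathSet → Set
  W ≼ U = V[ W ] ⊆ V[ U ] × (∀ u v → E[ W ] u v → E[ U ] u v)

  _≼f_ : PathSet → PathSet → Set
  W ≼f U = W ≼ U × in[ W ] ⊆ in[ U ] × in[ U ] ⊆ in[ W ]

  MaximalWave : PathSet → Set₁
  MaximalWave W = IsWave W × ¬ (∃ λ U → IsWave U × W ≼ U × ¬ (U ≐ W))

  FwdMaximalWave : PathSet → Set₁
  FwdMaximalWave W = IsWave W × ¬ (∃ λ U → IsWave U × W ≼f U × ¬ (U ≐ W))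

  StrictlyBelow : PathSet → PathSet → Set
  StrictlyBelow W U = RF ter[ W ] ⊆ RF ter[ U ] × ¬ (RF ter[ U ] ⊆ RF ter[ W ])

  LeMaximalWave : PathSet → Set₁
  LeMaximalWave W = IsWave W × ¬ (∃ λ U → IsWave U × StrictlyBelow W U)

-- Write X = RF(ter W). If a wave U has X ⊊ RF(ter U), then every path Q of U starts in A ⊆ X,
-- and if Q ends outside X, the vertex where Q leaves X for the last time is a terminal of W: an
-- edge can leave RF(ter W) only from a terminal of W. Prolonging each path of W by the part of U
-- beyond its terminal is therefore a wave forward-extending W, and a proper one, since some
-- terminal of U lies outside X (otherwise RF(ter U) ⊆ X).
--
-- Now let W be ≤-maximal and U a trimmed wave extending 𝓔(W). Every essential terminal of W lies
-- on U, so RF(ter W) ⊆ RF(ter U), with equality by ≤-maximality. Hence the essential terminals of U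
-- are essential terminals of W. An essential path of W starts in A, where no edge enters, so by
-- disjointness it is an initial segment of a path of U; that path ends at an essential terminal of
-- W, so disjointness again makes the two coincide, and 𝓔(W) = U.

module Submission where

open import Defs
open import Level using (0ℓ)
open import Axiom.ExcludedMiddle using (ExcludedMiddle)
open import Data.Empty using (⊥-elim)
open import Data.Nat using (suc)
open import Data.Nat.Properties using (<⇒≢; n<1+n)
open import Data.Product using (∃; ∃₂; _×_; _,_; proj₁; proj₂)
open import Data.Sum as Sum using (_⊎_; inj₁; inj₂)
open import Data.List using (List; []; _∷_; _++_; applyUpTo)
open import Data.List.Properties using (++-identityʳ; ∷-injective)
open import Data.List.Membership.Propositional using (_∈_; _∉_)
open import Data.List.Membership.Propositional.Properties
  using (∈-++⁺ˡ; ∈-++⁺ʳ; ∈-++⁻; ∈-applyUpTo⁺; ∈-applyUpTo⁻)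
open import Data.List.Relation.Binary.Disjoint.Propositional using (Disjoint)
open import Data.List.Relation.Unary.Any using (here; there)
open import Data.List.Relation.Unary.All as All using (All; [])
import Data.List.Relation.Unary.All.Properties as All
open import Data.List.Relation.Unary.AllPairs using ([]; _∷_)
open import Data.List.Relation.Unary.Linked using (Linked; [-]; _∷_)
import Data.List.Relation.Unary.Linked.Properties as Linked
open import Data.List.Relation.Unary.Unique.Propositional using (Unique)
import Data.List.Relation.Unary.Unique.Propositional.Properties as Unique
open import Relation.Nullary using (¬_; Dec; yes; no)
open import Relation.Nullary.Decidable using (decidable-stable)
open import Relation.Unary using (Pred; _⊆_)
open import Relation.Binary.PropositionalEquality
open import Function using (_∘_)

module _ {V : Set} (E : V → V → Set) (A B : Pred V 0ℓ) where
  open Web E A B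

  -- Vertex lists

  lastV∈ : ∀ x xs → lastV x xs ∈ x ∷ xs
  lastV∈ x []       = here refl
  lastV∈ x (y ∷ ys) = there (lastV∈ y ys)

  lastV-++ : ∀ x ps ss → lastV x (ps ++ ss) ≡ lastV (lastV x ps) ss
  lastV-++ x []       ss = refl
  lastV-++ x (y ∷ ps) ss = lastV-++ y ps ss

  lastV-++-cong : ∀ {ss} x ps y qs → lastV x ps ≡ lastV y qs → lastV x (ps ++ ss) ≡ lastV y (qs ++ ss)
  lastV-++-cong {ss} x ps y qs eq = begin
    lastV x (ps ++ ss)       ≡⟨ lastV-++ x ps ss ⟩
    lastV (lastV x ps) ss    ≡⟨ cong (λ w → lastV w ss) eq ⟩
    lastV (lastV y qs) ss    ≡⟨ lastV-++ y qs ss ⟨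
    lastV y (qs ++ ss)       ∎
    where open ≡-Reasoning

  ∈⇒split : ∀ {v} x xs → v ∈ x ∷ xs → ∃₂ λ ps ss → xs ≡ ps ++ ss × lastV x ps ≡ v
  ∈⇒split x xs       (here refl) = [] , xs , refl , refl
  ∈⇒split x (y ∷ ys) (there v∈)  with ps , ss , refl , eq ← ∈⇒split y ys v∈ = y ∷ ps , ss , refl , eq

  ∈-suffix⇒∈ : ∀ {u} x ps ss → u ∈ lastV x ps ∷ ss → u ∈ x ∷ ps ++ ss
  ∈-suffix⇒∈ x ps ss (here refl) = ∈-++⁺ˡ (lastV∈ x ps)
  ∈-suffix⇒∈ x ps ss (there u∈)  = ∈-++⁺ʳ (x ∷ ps) u∈

  Unique-++⁻ˡ : ∀ (xs ys : List V) → Unique (xs ++ ys) → Unique xs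
  Unique-++⁻ˡ []       ys _          = []
  Unique-++⁻ˡ (x ∷ xs) ys (x∉ ∷ uxs) = All.++⁻ˡ xs x∉ ∷ Unique-++⁻ˡ xs ys uxs

  Unique-++⁻ʳ : ∀ (xs ys : List V) → Unique (xs ++ ys) → Unique ys
  Unique-++⁻ʳ []       ys u         = u
  Unique-++⁻ʳ (x ∷ xs) ys (_ ∷ uxs) = Unique-++⁻ʳ xs ys uxs

  Unique-++⇒Disjoint : ∀ (xs ys : List V) → Unique (xs ++ ys) → Disjoint xs ys
  Unique-++⇒Disjoint (x ∷ xs) ys (x∉ ∷ _)   (here refl , v∈ys) = All.lookup x∉ (∈-++⁺ʳ xs v∈ys) refl
  Unique-++⇒Disjoint (x ∷ xs) ys (_ ∷ uxs) (there v∈xs , v∈ys) = Unique-++⇒Disjoint xs ys uxs (v∈xs , v∈ys)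

  Unique-head∉ : ∀ {x : V} {xs} → Unique (x ∷ xs) → x ∉ xs
  Unique-head∉ (x∉ ∷ _) x∈ = All.lookup x∉ x∈ refl

  Unique-suffix : ∀ x ps ss → Unique (x ∷ ps ++ ss) → Unique (lastV x ps ∷ ss)
  Unique-suffix x ps ss u =
    All.tabulate (λ t∈ss t≡ → Unique-++⇒Disjoint (x ∷ ps) ss u (lastV∈ x ps , subst (_∈ ss) (sym t≡) t∈ss))
    ∷ Unique-++⁻ʳ (x ∷ ps) ss u

  head∈suffix⇒lastV≡head : ∀ x ps ss → Unique (x ∷ ps ++ ss) → x ∈ lastV x ps ∷ ss → lastV x ps ≡ x
  head∈suffix⇒lastV≡head x ps ss u (here x≡)  = sym x≡
  head∈suffix⇒lastV≡head x ps ss u (there x∈) = ⊥-elim (Unique-++⇒Disjoint (x ∷ ps) ss u (here refl , x∈))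

  Linked-prefix : ∀ x ps ss → Linked E (x ∷ ps ++ ss) → Linked E (x ∷ ps)
  Linked-prefix x []       ss _       = [-]
  Linked-prefix x (p ∷ ps) ss (e ∷ l) = e ∷ Linked-prefix p ps ss l

  Linked-suffix : ∀ x ps ss → Linked E (x ∷ ps ++ ss) → Linked E (lastV x ps ∷ ss)
  Linked-suffix x []       ss l       = l
  Linked-suffix x (p ∷ ps) ss (_ ∷ l) = Linked-suffix p ps ss l

  Linked-join : ∀ x ps ss → Linked E (x ∷ ps) → Linked E (lastV x ps ∷ ss) → Linked E (x ∷ ps ++ ss)
  Linked-join x []       ss _        l = l
  Linked-join x (p ∷ ps) ss (e ∷ l₁) l = e ∷ Linked-join p ps ss l₁ l

  lastV-∉-prefix : ∀ x ps y ys → Unique (x ∷ ps ++ y ∷ ys) → lastV x (ps ++ y ∷ ys) ∉ x ∷ ps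
  lastV-∉-prefix x ps y ys u t∈ =
    Unique-++⇒Disjoint (x ∷ ps) (y ∷ ys) u (t∈ , subst (_∈ y ∷ ys) (sym (lastV-++ x ps (y ∷ ys))) (lastV∈ y ys))

  lastV-++-∈-prefix : ∀ {z} x ps ss → Unique (x ∷ ps ++ ss) → z ∈ x ∷ ps → lastV x (ps ++ ss) ≡ z →
                      ss ≡ [] × z ≡ lastV x ps
  lastV-++-∈-prefix x ps []       u z∈ refl rewrite ++-identityʳ ps = refl , refl
  lastV-++-∈-prefix x ps (y ∷ ys) u z∈ refl = ⊥-elim (lastV-∉-prefix x ps y ys u z∈)

  -- Paths

  ≈ₚ-sym : ∀ P Q → P ≈ₚ Q → Q ≈ₚ P
  ≈ₚ-sym (fin x xs) (fin y ys) (refl , refl) = refl , refl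
  ≈ₚ-sym (inf f)    (inf g)    f≗g n         = sym (f≗g n)

  ≈ₚ-trans : ∀ P Q R → P ≈ₚ Q → Q ≈ₚ R → P ≈ₚ R
  ≈ₚ-trans (fin x xs) (fin y ys) (fin z zs) (refl , refl) (refl , refl) = refl , refl
  ≈ₚ-trans (inf f)    (inf g)    (inf h)    f≗g          g≗h n         = trans (f≗g n) (g≗h n)

  TerIs-resp-≈ₚ : ∀ P Q {z} → P ≈ₚ Q → TerIs P z → TerIs Q z
  TerIs-resp-≈ₚ (fin x xs) (fin y ys) (refl , refl) t = t

  VOf-resp-≈ₚ : ∀ P Q {z} → P ≈ₚ Q → VOf P z → VOf Q z
  VOf-resp-≈ₚ (fin x xs) (fin y ys) (refl , refl) z∈      = z∈
  VOf-resp-≈ₚ (inf f)    (inf g)    f≗g          (n , eq) = n , trans (sym (f≗g n)) eq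

  EOf-resp-≈ₚ : ∀ P Q {u v} → P ≈ₚ Q → EOf P u v → EOf Q u v
  EOf-resp-≈ₚ (fin x xs) (fin y ys) (refl , refl) c = c
  EOf-resp-≈ₚ (inf f)    (inf g)    f≗g (n , eu , ev) =
    n , trans (sym (f≗g n)) eu , trans (sym (f≗g (suc n))) ev

  TerIs-functional : ∀ P {a b} → TerIs P a → TerIs P b → a ≡ b
  TerIs-functional (fin x xs) refl refl = refl

  inP∈VOf : ∀ P → VOf P (inP P)
  inP∈VOf (fin x xs) = here refl
  inP∈VOf (inf f)    = 0 , refl

  TerIs⇒VOf : ∀ P {z} → TerIs P z → VOf P z
  TerIs⇒VOf (fin x xs) refl = lastV∈ x xs

  lastSplit-unique : ∀ (S : Pred V 0ℓ) x ps₁ ss₁ ps₂ ss₂ → ps₁ ++ ss₁ ≡ ps₂ ++ ss₂ →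
                     S (lastV x ps₁) → S (lastV x ps₂) → All (λ w → ¬ S w) ss₁ → All (λ w → ¬ S w) ss₂ →
                     ps₁ ≡ ps₂ × ss₁ ≡ ss₂
  lastSplit-unique S x []        ss₁ []        ss₂ eq _ _ _ _ = refl , eq
  lastSplit-unique S x []        ss₁ (y ∷ ps₂) ss₂ refl _ t₂∈S ss₁∩S=∅ _ =
    ⊥-elim (All.lookup ss₁∩S=∅ (∈-++⁺ˡ (lastV∈ y ps₂)) t₂∈S)
  lastSplit-unique S x (y ∷ ps₁) ss₁ []        ss₂ refl t₁∈S _ _ ss₂∩S=∅ =
    ⊥-elim (All.lookup ss₂∩S=∅ (∈-++⁺ˡ (lastV∈ y ps₁)) t₁∈S)
  lastSplit-unique S x (y ∷ ps₁) ss₁ (y′ ∷ ps₂) ss₂ eq t₁∈S t₂∈S ss₁∩S=∅ ss₂∩S=∅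
    with refl , eq′ ← ∷-injective eq
    with refl , refl ← lastSplit-unique S y ps₁ ss₁ ps₂ ss₂ eq′ t₁∈S t₂∈S ss₁∩S=∅ ss₂∩S=∅
    = refl , refl

  Consec⇒∈ : ∀ {u v} xs → Consec u v xs → u ∈ xs
  Consec⇒∈ _        here      = here refl
  Consec⇒∈ (_ ∷ xs) (there c) = there (Consec⇒∈ xs c)

  EOf⇒VOf : ∀ P {u v} → EOf P u v → VOf P u
  EOf⇒VOf (fin x xs) c          = Consec⇒∈ (x ∷ xs) c
  EOf⇒VOf (inf f)    (n , eu , _) = n , eu

  Consec-++ : ∀ {u v} x ps ss → Consec u v (x ∷ ps) → Consec u v (x ∷ ps ++ ss)
  Consec-++ x (p ∷ ps) ss here      = here
  Consec-++ x (p ∷ ps) ss (there c) = there (Consec-++ p ps ss c)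

  Consec-head : ∀ {y} q qs → q ∉ qs → Consec q y (q ∷ qs) → ∃ λ qs′ → qs ≡ y ∷ qs′
  Consec-head q (y ∷ qs′) q∉ here      = qs′ , refl
  Consec-head q qs        q∉ (there c) = ⊥-elim (q∉ (Consec⇒∈ qs c))

  Consec-tail : ∀ {u v q} ys → q ∉ ys → u ∈ ys → Consec u v (q ∷ ys) → Consec u v ys
  Consec-tail ys q∉ u∈ here      = ⊥-elim (q∉ u∈)
  Consec-tail ys q∉ u∈ (there c) = c

  Consec-prefix : ∀ q qs rs → Unique (q ∷ qs) →
                  (∀ {u v} → Consec u v (q ∷ rs) → u ∈ q ∷ qs → Consec u v (q ∷ qs)) →
                  ∃ λ rest → qs ≡ rs ++ rest
  Consec-prefix q qs       []       _           _     = qs , refl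
  Consec-prefix q qs       (y ∷ rs) u@(_ ∷ uqs) edges
    with qs′ , refl ← Consec-head q qs (Unique-head∉ u) (edges here (here refl))
    with rest , refl ← Consec-prefix y qs′ rs uqs
                         (λ c u∈ → Consec-tail (y ∷ qs′) (Unique-head∉ u) u∈ (edges (there c) (there u∈)))
    = rest , refl

  Linked⇒pred : ∀ {v} x xs → Linked E (x ∷ xs) → v ∈ xs → ∃ λ u → E u v
  Linked⇒pred x (y ∷ ys) (e ∷ _) (here refl) = x , e
  Linked⇒pred x (y ∷ ys) (_ ∷ l) (there v∈)  = Linked⇒pred y ys l v∈

  no-in-edge⇒head : ∀ {r} q qs → Linked E (q ∷ qs) → (∀ u → ¬ E u r) → r ∈ q ∷ qs → r ≡ q
  no-in-edge⇒head q qs linked no-in (here r≡q) = r≡q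
  no-in-edge⇒head q qs linked no-in (there r∈) = ⊥-elim (no-in _ (proj₂ (Linked⇒pred q qs linked r∈)))

  EndsInB : RawPath → Set
  EndsInB P = ∃ λ b → TerIs P b × B b

  IsPath-suffix : ∀ x ps ss → IsPath (fin x (ps ++ ss)) → IsPath (fin (lastV x ps) ss)
  IsPath-suffix x ps ss (u , l) = Unique-suffix x ps ss u , Linked-suffix x ps ss l

  EndsInB-suffix : ∀ x ps ss → EndsInB (fin x (ps ++ ss)) → EndsInB (fin (lastV x ps) ss)
  EndsInB-suffix x ps ss (b , refl , b∈B) = b , sym (lastV-++ x ps ss) , b∈B

  PathToB-suffix : ∀ x ps ss → IsPath (fin x (ps ++ ss)) → EndsInB (fin x (ps ++ ss)) →
                   PathToB (lastV x ps) (fin (lastV x ps) ss)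
  PathToB-suffix x ps ss p ends = IsPath-suffix x ps ss p , refl , EndsInB-suffix x ps ss ends

  IsPath-infPrefix : ∀ f → IsPath (inf f) → ∀ n → IsPath (fin (f 0) (applyUpTo (λ i → f (suc i)) n))
  IsPath-infPrefix f (inj , step) n =
    Unique.applyUpTo⁺₁ f (suc n) (λ i<j _ eq → <⇒≢ i<j (inj eq)) , Linked.applyUpTo⁺₂ f (suc n) step

  IsPath-cons : ∀ {t p ps} → t ∉ p ∷ ps → E t p → IsPath (fin p ps) → IsPath (fin t (p ∷ ps))
  IsPath-cons {t} {p} {ps} t∉ e (u , l) =
    All.tabulate (λ u∈ t≡u → t∉ (subst (_∈ p ∷ ps) (sym t≡u) u∈)) ∷ u , e ∷ l

  IsPath-prefix : ∀ x ps ss → IsPath (fin x (ps ++ ss)) → IsPath (fin x ps)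
  IsPath-prefix x ps ss (u , l) = Unique-++⁻ˡ (x ∷ ps) ss u , Linked-prefix x ps ss l

  IsPath-join : ∀ x ps ss → IsPath (fin x ps) → IsPath (fin (lastV x ps) ss) → Disjoint (x ∷ ps) ss →
                IsPath (fin x (ps ++ ss))
  IsPath-join x ps ss (u₁ , l₁) (_ ∷ u₂ , l₂) disj = Unique.++⁺ u₁ u₂ disj , Linked-join x ps ss l₁ l₂

  EndsInB-join : ∀ x ps ss → EndsInB (fin (lastV x ps) ss) → EndsInB (fin x (ps ++ ss))
  EndsInB-join x ps ss (b , refl , b∈B) = b , lastV-++ x ps ss , b∈B

  PathAB-splice : ∀ c cs₁ cs₂ p ps₁ ss → IsPath (fin c (cs₁ ++ cs₂)) → A c →
                  IsPath (fin p (ps₁ ++ ss)) → EndsInB (fin p (ps₁ ++ ss)) →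
                  lastV c cs₁ ≡ lastV p ps₁ → Disjoint (c ∷ cs₁) ss → PathAB (fin c (cs₁ ++ ss))
  PathAB-splice c cs₁ cs₂ p ps₁ ss pathC c∈A pathP endsP meet disj =
    IsPath-join c cs₁ ss (IsPath-prefix c cs₁ cs₂ pathC) (at-meet IsPath (IsPath-suffix p ps₁ ss pathP)) disj ,
    c∈A , EndsInB-join c cs₁ ss (at-meet EndsInB (EndsInB-suffix p ps₁ ss endsP))
    where
    at-meet : (F : RawPath → Set) → F (fin (lastV p ps₁) ss) → F (fin (lastV c cs₁) ss)
    at-meet F = subst (λ w → F (fin w ss)) (sym meet)

  -- Waves and the sets RF and 𝓔

  module Wave {W : PathSet} (wave : IsWave W) where

    warp : IsWarp W
    warp = proj₁ wave

    paths : ∀ P → W P → IsPath P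
    paths = proj₁ (proj₁ wave)

    disjoint : ∀ P Q → W P → W Q → ∀ v → VOf P v → VOf Q v → P ≈ₚ Q
    disjoint = proj₂ (proj₁ wave)

    in⊆A : in[ W ] ⊆ A
    in⊆A = proj₁ (proj₂ wave)

    blocks : ∀ P → PathAB P → Meets P ter[ W ]
    blocks = proj₂ (proj₂ wave)

  ter[]-on-path : ∀ {U Q z} → IsWarp U → U Q → ter[ U ] z → VOf Q z → TerIs Q z
  ter[]-on-path {Q = Q} (_ , disjoint) Q∈U (Q′ , Q′∈U , tQ′) z∈Q =
    TerIs-resp-≈ₚ Q′ Q (disjoint Q′ Q Q′∈U Q∈U _ (TerIs⇒VOf Q′ tQ′) z∈Q) tQ′

  Ess⊆ter[EssW] : ∀ W → Ess ter[ W ] ⊆ ter[ EssW W ]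
  Ess⊆ter[EssW] W s∈Ess@((R , R∈W , tR) , _) = R , (R∈W , _ , tR , s∈Ess) , tR

  E[]-on-path : ∀ {U Q u v} → IsWarp U → U Q → VOf Q u → E[ U ] u v → EOf Q u v
  E[]-on-path {Q = Q} (_ , disjoint) Q∈U u∈Q (Q′ , Q′∈U , e∈Q′) =
    EOf-resp-≈ₚ Q′ Q (disjoint Q′ Q Q′∈U Q∈U _ (EOf⇒VOf Q′ e∈Q′) u∈Q) e∈Q′

  ⊆RF : ∀ S → S ⊆ RF S
  ⊆RF S {v} v∈S P (_ , refl , _) = v , inP∈VOf P , v∈S

  A⊆RF-ter : ∀ W → IsWave W → A ⊆ RF ter[ W ]
  A⊆RF-ter W (_ , _ , blocks) a∈A P (p , refl , ends) = blocks P (p , a∈A , ends)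

  Ess-last : ∀ S x ps ss → IsPath (fin x (ps ++ ss)) → EndsInB (fin x (ps ++ ss)) →
             S (lastV x ps) → All (λ w → ¬ S w) ss → Ess S (lastV x ps)
  Ess-last S x ps ss p ends t∈S ss∩S=∅ = t∈S , _ , PathToB-suffix x ps ss p ends , only-t
    where
    only-t : ∀ u → u ∈ lastV x ps ∷ ss → S u → u ≡ lastV x ps
    only-t u (here u≡t) _   = u≡t
    only-t u (there u∈) u∈S = ⊥-elim (All.lookup ss∩S=∅ u∈ u∈S)

  ¬RF-on-avoiding-tail : ∀ S x ss {u} → IsPath (fin x ss) → EndsInB (fin x ss) →
                         All (λ w → ¬ S w) ss → u ∈ ss → ¬ RF S u
  ¬RF-on-avoiding-tail S x ss path ends ss∩S=∅ u∈ u∈RF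
    with a , c , refl , refl ← ∈⇒split x ss (there u∈)
    with u∈RF _ (PathToB-suffix x a c path ends)
  ... | _ , here refl , w∈S = All.lookup ss∩S=∅ u∈ w∈S
  ... | _ , there w∈c , w∈S = All.lookup ss∩S=∅ (∈-++⁺ʳ a w∈c) w∈S

  data _⊑_ : RawPath → RawPath → Set where
    ⊑-refl : ∀ {P} → P ⊑ P
    ⊑-++   : ∀ {x xs ss} → fin x xs ⊑ fin x (xs ++ ss)

  VOf-⊑ : ∀ {P Q v} → P ⊑ Q → VOf P v → VOf Q v
  VOf-⊑ ⊑-refl v∈ = v∈
  VOf-⊑ ⊑-++   v∈ = ∈-++⁺ˡ v∈

  EOf-⊑ : ∀ {P Q u v} → P ⊑ Q → EOf P u v → EOf Q u v
  EOf-⊑ ⊑-refl           c = c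
  EOf-⊑ (⊑-++ {x} {xs}) c = Consec-++ x xs _ c

  inP-⊑ : ∀ {P Q} → P ⊑ Q → inP P ≡ inP Q
  inP-⊑ ⊑-refl = refl
  inP-⊑ ⊑-++   = refl

  ≼f-by-prefixes : ∀ {W W′} → (∀ {P} → W P → ∃ λ Q → W′ Q × P ⊑ Q) → in[ W′ ] ⊆ in[ W ] → W ≼f W′
  ≼f-by-prefixes {W} {W′} prolong in[W′]⊆ = (V⊆ , E⊆) , in⊆ , in[W′]⊆
    where
    V⊆ : V[ W ] ⊆ V[ W′ ]
    V⊆ (P , P∈W , v∈P) with Q , Q∈W′ , P⊑Q ← prolong P∈W = Q , Q∈W′ , VOf-⊑ P⊑Q v∈P
    E⊆ : ∀ u v → E[ W ] u v → E[ W′ ] u v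
    E⊆ u v (P , P∈W , e∈P) with Q , Q∈W′ , P⊑Q ← prolong P∈W = Q , Q∈W′ , EOf-⊑ P⊑Q e∈P
    in⊆ : in[ W ] ⊆ in[ W′ ]
    in⊆ (P , P∈W , refl) with Q , Q∈W′ , P⊑Q ← prolong P∈W = Q , Q∈W′ , sym (inP-⊑ P⊑Q)

  maximal⇒fwdMaximal : ∀ W → MaximalWave W → FwdMaximalWave W
  maximal⇒fwdMaximal W (W-wave , no-ext) =
    W-wave , λ (U , U-wave , (W≼U , _) , U≉W) → no-ext (U , U-wave , W≼U , U≉W)

  module _ (lem : ∀ {ℓ} → ExcludedMiddle ℓ) where

    decide : (P : Set) → Dec P
    decide P = lem

    ⊆-or-escape : ∀ (S S′ : Pred V 0ℓ) → S ⊆ S′ ⊎ ∃ λ u → S u × ¬ S′ u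
    ⊆-or-escape S S′ with decide (∃ λ u → S u × ¬ S′ u)
    ... | yes escape = inj₂ escape
    ... | no ¬escape = inj₁ λ {u} u∈S → decidable-stable (decide (S′ u)) (λ u∉S′ → ¬escape (u , u∈S , u∉S′))

    splitAtLast : ∀ S x xs → Meets (fin x xs) S →
                  ∃₂ λ ps ss → xs ≡ ps ++ ss × S (lastV x ps) × All (λ w → ¬ S w) ss
    splitAtLast S x [] (_ , here refl , x∈S) = [] , [] , refl , x∈S , []
    splitAtLast S x (y ∷ ys) meets with decide (Meets (fin y ys) S)
    ... | yes meets′ with ps , ss , refl , t∈S , rest ← splitAtLast S y ys meets′ =
      y ∷ ps , ss , refl , t∈S , rest
    ... | no ¬meets′ = [] , y ∷ ys , refl , x∈S meets , All.tabulate (λ u∈ u∈S → ¬meets′ (_ , u∈ , u∈S))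
      where
      x∈S : Meets (fin x (y ∷ ys)) S → S x
      x∈S (_ , here refl , u∈S) = u∈S
      x∈S (u , there u∈ , u∈S)  = ⊥-elim (¬meets′ (u , u∈ , u∈S))

    ¬RF⇒avoiding : ∀ S {v} → ¬ RF S v → ∃ λ P → PathToB v P × ¬ Meets P S
    ¬RF⇒avoiding S {v} v∉RF with decide (∃ λ P → PathToB v P × ¬ Meets P S)
    ... | yes avoiding = avoiding
    ... | no ¬avoiding = ⊥-elim (v∉RF meets)
      where
      meets : RF S v
      meets P toB = decidable-stable (decide (Meets P S)) (λ ¬m → ¬avoiding (P , toB , ¬m))

    RF-mono-Ess : ∀ S S′ → Ess S ⊆ RF S′ → RF S ⊆ RF S′
    RF-mono-Ess S S′ Ess⊆ v∈RF P@(fin p ps) toB@(path , refl , ends)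
      with ps₁ , ss , refl , t∈S , ss∩S=∅ ← splitAtLast S p ps (v∈RF P toB)
      with w , w∈ , w∈S′ ← Ess⊆ (Ess-last S p ps₁ ss path ends t∈S ss∩S=∅) _ (PathToB-suffix p ps₁ ss path ends)
      = w , ∈-suffix⇒∈ p ps₁ ss w∈ , w∈S′

    -- The last S-vertex s on a path witnessing t ∈ Ess S′ lies in Ess S ⊆ RF S′, so the rest
    -- of the path from s meets S′; the path meets S′ only at its start t, hence s = t.
    Ess-transfer : ∀ S S′ → RF S′ ⊆ RF S → Ess S ⊆ RF S′ → Ess S′ ⊆ Ess S
    Ess-transfer S S′ RF⊆ Ess⊆ (t∈S′ , fin t ps , toB@(path@(unique , _) , refl , ends) , only-t)
      with ps₁ , ss , refl , s∈S , ss∩S=∅ ← splitAtLast S t ps (RF⊆ (⊆RF S′ t∈S′) _ toB)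
      with w , w∈ , w∈S′ ← Ess⊆ (Ess-last S t ps₁ ss path ends s∈S ss∩S=∅) _ (PathToB-suffix t ps₁ ss path ends)
      = subst (Ess S) s≡t (Ess-last S t ps₁ ss path ends s∈S ss∩S=∅)
      where
      s≡t : lastV t ps₁ ≡ t
      s≡t = head∈suffix⇒lastV≡head t ps₁ ss unique
              (subst (_∈ lastV t ps₁ ∷ ss) (only-t w (∈-suffix⇒∈ t ps₁ ss w∈) w∈S′) w∈)

    -- If t′ ∉ RF T, a T-avoiding path from t′ to B either passes through t, or
    -- t followed by it is a path; as t ∈ RF T, only t itself can lie in T.
    RF-exit : ∀ T {t t′} → RF T t → E t t′ → ¬ RF T t′ → T t
    RF-exit T {t} t∈RF e t′∉RF with ¬RF⇒avoiding T t′∉RF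
    ... | fin p ps , toB@((u , l) , refl , ends) , ¬meets with decide (t ∈ p ∷ ps)
    ...   | yes t∈ with ps₁ , ss , refl , refl ← ∈⇒split p ps t∈ =
      ⊥-elim (¬meets (avoid (t∈RF _ (PathToB-suffix p ps₁ ss (u , l) ends))))
      where
      avoid : Meets (fin (lastV p ps₁) ss) T → Meets (fin p (ps₁ ++ ss)) T
      avoid (w , w∈ , w∈T) = w , ∈-suffix⇒∈ p ps₁ ss w∈ , w∈T
    ...   | no t∉ with t∈RF (fin t (p ∷ ps)) (IsPath-cons t∉ e (u , l) , refl , ends)
    ...     | _ , here refl , t∈T = t∈T
    ...     | w , there w∈ , w∈T  = ⊥-elim (¬meets (w , w∈ , w∈T))

    -- Follow c ∷ cs up to the last vertex of P on it, then P: this is an A–B path.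
    blocking-glue : ∀ S → (∀ P → PathAB P → Meets P S) →
                    ∀ c cs → IsPath (fin c cs) → A c →
                    ∀ p ps → IsPath (fin p ps) → EndsInB (fin p ps) → p ∈ c ∷ cs →
                    Meets (fin c cs) S ⊎ Meets (fin p ps) S
    blocking-glue S blocks c cs pathC c∈A p ps pathP endsP p∈
      with ps₁ , ss , refl , w∈ , ss∩C=∅ ← splitAtLast (_∈ c ∷ cs) p ps (p , here refl , p∈)
      with cs₁ , cs₂ , refl , w≡ ← ∈⇒split c cs w∈
      with z , z∈ , z∈S ← blocks (fin c (cs₁ ++ ss))
             (PathAB-splice c cs₁ cs₂ p ps₁ ss pathC c∈A pathP endsP w≡
               (λ (z∈C , z∈ss) → All.lookup ss∩C=∅ z∈ss (∈-++⁺ˡ z∈C)))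
      = Sum.map (λ z∈C → z , ∈-++⁺ˡ z∈C , z∈S) (λ z∈ss → z , ∈-++⁺ʳ (p ∷ ps₁) z∈ss , z∈S)
                (∈-++⁻ (c ∷ cs₁) z∈)

    V⊆RF-ter : ∀ U → IsWave U → V[ U ] ⊆ RF ter[ U ]
    V⊆RF-ter U (warp@(paths , _) , in⊆A , blocks) (Q@(fin q qs) , Q∈U , v∈Q) (fin _ ps) (pathP , refl , endsP)
      with ps′ , ss′ , refl , refl ← ∈⇒split q qs v∈Q
      with path-q@(unique-q , _) ← paths Q Q∈U
      with blocking-glue ter[ U ] blocks q ps′ (IsPath-prefix q ps′ ss′ path-q) (in⊆A (Q , Q∈U , refl))
             (lastV q ps′) ps pathP endsP (lastV∈ q ps′)
    ... | inj₂ meets = meets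
    ... | inj₁ (z , z∈ , z∈ter)
      with refl , refl ← lastV-++-∈-prefix q ps′ ss′ unique-q z∈ (ter[]-on-path warp Q∈U z∈ter (∈-++⁺ˡ z∈))
      = z , here refl , z∈ter
    V⊆RF-ter U (warp@(paths , _) , in⊆A , blocks) (Q@(inf f) , Q∈U , n , refl) (fin _ ps) (pathP , refl , endsP)
      with blocking-glue ter[ U ] blocks (f 0) (applyUpTo (λ i → f (suc i)) n)
             (IsPath-infPrefix f (paths Q Q∈U) n) (in⊆A (Q , Q∈U , refl))
             (f n) ps pathP endsP (∈-applyUpTo⁺ f (n<1+n n))
    ... | inj₂ meets = meets
    ... | inj₁ (z , z∈ , z∈ter) with i , _ , refl ← ∈-applyUpTo⁻ f z∈ =
      ⊥-elim (ter[]-on-path warp Q∈U z∈ter (i , refl))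

    module ForwardExtension (W : PathSet) (W-wave : IsWave W) (U : PathSet) (U-wave : IsWave U)
                            (W<U : StrictlyBelow W U) where

      X : Pred V 0ℓ
      X = RF ter[ W ]

      V[W]⊆X : V[ W ] ⊆ X
      V[W]⊆X = V⊆RF-ter W W-wave

      open Wave W-wave using ()
        renaming (paths to W-paths; disjoint to W-disjoint; in⊆A to W-in⊆A; blocks to W-blocks)
      open Wave U-wave using ()
        renaming (warp to U-warp; paths to U-paths; disjoint to U-disjoint; in⊆A to U-in⊆A)

      record Continuation (t : V) (ss : List V) : Set where
        constructor continuation
        field
          start    : V
          before   : List V
          on-U     : U (fin start (before ++ ss))
          through  : lastV start before ≡ t
          beyond   : All (λ w → ¬ X w) ss
          nonempty : ss ≢ []

        vertices : List V
        vertices = start ∷ before ++ ss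

        ss⊆vertices : ∀ {v} → v ∈ ss → v ∈ vertices
        ss⊆vertices = ∈-++⁺ʳ (start ∷ before)

        t∈ : t ∈ vertices
        t∈ = ∈-++⁺ˡ (subst (_∈ start ∷ before) through (lastV∈ start before))

        tail-path : IsPath (fin t ss)
        tail-path = subst (λ w → IsPath (fin w ss)) through (IsPath-suffix start before ss (U-paths _ on-U))

      open Continuation using (vertices; ss⊆vertices; t∈; beyond; tail-path)

      data W⁺ : PathSet where
        kept     : ∀ {P} → W P → (∀ {t ss} → TerIs P t → ¬ Continuation t ss) → W⁺ P
        extended : ∀ {r rs ss} → W (fin r rs) → Continuation (lastV r rs) ss → W⁺ (fin r (rs ++ ss))

      continuations-agree : ∀ {t₁ ss₁ t₂ ss₂} (c₁ : Continuation t₁ ss₁) (c₂ : Continuation t₂ ss₂) →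
                            X t₁ → X t₂ → ∀ {v} → v ∈ vertices c₁ → v ∈ vertices c₂ → t₁ ≡ t₂ × ss₁ ≡ ss₂
      continuations-agree (continuation q₁ ps₁ Q₁∈U refl out₁ _) (continuation q₂ ps₂ Q₂∈U refl out₂ _)
                          x₁ x₂ v∈₁ v∈₂
        with refl , eq ← U-disjoint _ _ Q₁∈U Q₂∈U _ v∈₁ v∈₂
        with refl , refl ← lastSplit-unique X q₁ ps₁ _ ps₂ _ eq x₁ x₂ out₁ out₂
        = refl , refl

      X-ter : ∀ {r rs} → W (fin r rs) → X (lastV r rs)
      X-ter {r} {rs} R∈W = V[W]⊆X (fin r rs , R∈W , lastV∈ r rs)

      W⁺-paths : ∀ P → W⁺ P → IsPath P
      W⁺-paths P (kept P∈W _) = W-paths P P∈W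
      W⁺-paths _ (extended {r} {rs} {ss} R∈W c) =
        IsPath-join r rs ss (W-paths _ R∈W) (tail-path c)
          (λ (v∈R , v∈ss) → All.lookup (beyond c) v∈ss (V[W]⊆X (_ , R∈W , v∈R)))

      kept-meets-extended : ∀ {P r rs ss v} → W P → (∀ {t ss} → TerIs P t → ¬ Continuation t ss) →
                            W (fin r rs) → Continuation (lastV r rs) ss → VOf P v → ¬ v ∈ r ∷ rs ++ ss
      kept-meets-extended {P} {r} {rs} P∈W no-cont R∈W c v∈P v∈ with ∈-++⁻ (r ∷ rs) v∈
      ... | inj₁ v∈R = no-cont (TerIs-resp-≈ₚ (fin r rs) P (W-disjoint _ _ R∈W P∈W _ v∈R v∈P) refl) c
      ... | inj₂ v∈ss = All.lookup (beyond c) v∈ss (V[W]⊆X (P , P∈W , v∈P))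

      extended-meet⇒same-base : ∀ {r₁ rs₁ ss₁ r₂ rs₂ ss₂ v} →
                                W (fin r₁ rs₁) → Continuation (lastV r₁ rs₁) ss₁ →
                                W (fin r₂ rs₂) → Continuation (lastV r₂ rs₂) ss₂ →
                                v ∈ r₁ ∷ rs₁ ++ ss₁ → v ∈ r₂ ∷ rs₂ ++ ss₂ → fin r₁ rs₁ ≈ₚ fin r₂ rs₂
      extended-meet⇒same-base {r₁} {rs₁} {_} {r₂} {rs₂} R₁∈W c₁ R₂∈W c₂ v∈₁ v∈₂
        with ∈-++⁻ (r₁ ∷ rs₁) v∈₁ | ∈-++⁻ (r₂ ∷ rs₂) v∈₂
      ... | inj₁ v∈R₁ | inj₁ v∈R₂ = W-disjoint _ _ R₁∈W R₂∈W _ v∈R₁ v∈R₂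
      ... | inj₁ v∈R₁ | inj₂ v∈ss₂ = ⊥-elim (All.lookup (beyond c₂) v∈ss₂ (V[W]⊆X (_ , R₁∈W , v∈R₁)))
      ... | inj₂ v∈ss₁ | inj₁ v∈R₂ = ⊥-elim (All.lookup (beyond c₁) v∈ss₁ (V[W]⊆X (_ , R₂∈W , v∈R₂)))
      ... | inj₂ v∈ss₁ | inj₂ v∈ss₂
        with t≡ , _ ← continuations-agree c₁ c₂ (X-ter R₁∈W) (X-ter R₂∈W)
                        (ss⊆vertices c₁ v∈ss₁) (ss⊆vertices c₂ v∈ss₂)
        = W-disjoint _ _ R₁∈W R₂∈W _ (lastV∈ r₁ rs₁) (subst (_∈ r₂ ∷ rs₂) (sym t≡) (lastV∈ r₂ rs₂))

      W⁺-disjoint : ∀ P Q → W⁺ P → W⁺ Q → ∀ v → VOf P v → VOf Q v → P ≈ₚ Q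
      W⁺-disjoint P Q (kept P∈W _) (kept Q∈W _) v v∈P v∈Q = W-disjoint P Q P∈W Q∈W v v∈P v∈Q
      W⁺-disjoint P _ (kept P∈W no-cont) (extended R∈W c) v v∈P v∈Q =
        ⊥-elim (kept-meets-extended P∈W no-cont R∈W c v∈P v∈Q)
      W⁺-disjoint _ Q (extended R∈W c) (kept Q∈W no-cont) v v∈P v∈Q =
        ⊥-elim (kept-meets-extended Q∈W no-cont R∈W c v∈Q v∈P)
      W⁺-disjoint _ _ (extended R₁∈W c₁) (extended R₂∈W c₂) v v∈₁ v∈₂
        with refl , refl ← extended-meet⇒same-base R₁∈W c₁ R₂∈W c₂ v∈₁ v∈₂
        with _ , refl ← continuations-agree c₁ c₂ (X-ter R₁∈W) (X-ter R₂∈W) (t∈ c₁) (t∈ c₂)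
        = refl , refl

      W⁺-in⊆A : in[ W⁺ ] ⊆ A
      W⁺-in⊆A (P , kept P∈W _ , refl) = W-in⊆A (P , P∈W , refl)
      W⁺-in⊆A (_ , extended R∈W _ , refl) = W-in⊆A (_ , R∈W , refl)

      no-continuation-at-ter[U] : ∀ {t ss} → ter[ U ] t → ¬ Continuation t ss
      no-continuation-at-ter[U] t∈TU c@(continuation q ps Q∈U refl _ nonempty)
        with U-paths _ Q∈U
      ... | unique , _ with ss≡[] , _ ← lastV-++-∈-prefix q ps _ unique (lastV∈ q ps)
                                          (ter[]-on-path U-warp Q∈U t∈TU (t∈ c))
        = nonempty ss≡[]

      ter-kept : ∀ {R t} → W R → TerIs R t → ter[ U ] t → W⁺ R
      ter-kept {R} R∈W tR t∈TU =
        kept R∈W λ tR′ → no-continuation-at-ter[U] (subst ter[ U ] (TerIs-functional R tR tR′) t∈TU)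

      -- Q leaves X after its last X-vertex t; the edge leaving X starts at a terminal of W
      -- (RF-exit), and the path of W ending there is prolonged along Q up to u.
      ter[U]∖X⊆ter[W⁺] : ∀ {u} → ter[ U ] u → ¬ X u → ter[ W⁺ ] u
      ter[U]∖X⊆ter[W⁺] (Q@(fin q qs) , Q∈U , refl) u∉X
        with splitAtLast X q qs (q , here refl , A⊆RF-ter W W-wave (U-in⊆A (Q , Q∈U , refl)))
      ... | ps , [] , refl , t∈X , _ = ⊥-elim (u∉X (subst X (sym (lastV-++ q ps [])) t∈X))
      ... | ps , t′ ∷ ss′ , refl , t∈X , out with Linked-suffix q ps (t′ ∷ ss′) (proj₂ (U-paths Q Q∈U))
      ...   | e ∷ _ with RF-exit ter[ W ] t∈X e (All.lookup out (here refl))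
      ...     | fin r rs , R∈W , tR =
        fin r (rs ++ t′ ∷ ss′) , extended R∈W (continuation q ps Q∈U (sym tR) out λ ()) ,
        lastV-++-cong r rs q ps tR

      -- After its last W-terminal t, P avoids ter W and hence X, and it meets ter U at some u:
      -- either u ∉ X, or u = t is a terminal of both waves and the path of W ending at t is kept.
      W⁺-blocks : ∀ P → PathAB P → Meets P ter[ W⁺ ]
      W⁺-blocks P@(fin p ps) (path , p∈A , ends)
        with ps₁ , ss , refl , t∈T , ss∩T=∅ ← splitAtLast ter[ W ] p ps (W-blocks P (path , p∈A , ends))
        with u , u∈ , u∈TU ← proj₁ W<U (⊆RF ter[ W ] t∈T) _ (PathToB-suffix p ps₁ ss path ends)
        with decide (X u) | u∈
      ... | no u∉X | _ = u , ∈-suffix⇒∈ p ps₁ ss u∈ , ter[U]∖X⊆ter[W⁺] u∈TU u∉X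
      ... | yes u∈X | there u∈ss =
        ⊥-elim (¬RF-on-avoiding-tail ter[ W ] _ ss (IsPath-suffix p ps₁ ss path) (EndsInB-suffix p ps₁ ss ends)
                  ss∩T=∅ u∈ss u∈X)
      ... | yes _ | here refl with R , R∈W , tR ← t∈T =
        u , ∈-suffix⇒∈ p ps₁ ss u∈ , R , ter-kept R∈W tR u∈TU , tR

      W⁺-wave : IsWave W⁺
      W⁺-wave = (W⁺-paths , W⁺-disjoint) , W⁺-in⊆A , W⁺-blocks

      W≼fW⁺ : W ≼f W⁺
      W≼fW⁺ = ≼f-by-prefixes prolong in[W⁺]⊆
        where
        prolong : ∀ {P} → W P → ∃ λ Q → W⁺ Q × P ⊑ Q
        prolong {P} P∈W with decide (∃₂ λ t ss → TerIs P t × Continuation t ss)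
        ... | no ¬cont = P , kept P∈W (λ tP c → ¬cont (_ , _ , tP , c)) , ⊑-refl
        prolong {fin r rs} P∈W | yes (_ , _ , refl , c) = _ , extended P∈W c , ⊑-++
        in[W⁺]⊆ : in[ W⁺ ] ⊆ in[ W ]
        in[W⁺]⊆ (P , kept P∈W _ , refl) = P , P∈W , refl
        in[W⁺]⊆ (_ , extended R∈W _ , refl) = _ , R∈W , refl

      W⁺≉W : ¬ (W⁺ ≐ W)
      W⁺≉W (W⁺⊆W , _) with ⊆-or-escape ter[ U ] X
      ... | inj₁ ter[U]⊆X = proj₂ W<U (RF-mono-Ess ter[ U ] ter[ W ] (λ (u∈TU , _) → ter[U]⊆X u∈TU))
      ... | inj₂ (u , u∈TU , u∉X)
        with N , N∈W⁺ , tN ← ter[U]∖X⊆ter[W⁺] u∈TU u∉X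
        with P , P∈W , N≈P ← W⁺⊆W N N∈W⁺
        = u∉X (V[W]⊆X (P , P∈W , VOf-resp-≈ₚ N P N≈P (TerIs⇒VOf N tN)))

    fwdMaximal⇒≤Maximal : ∀ W → FwdMaximalWave W → LeMaximalWave W
    fwdMaximal⇒≤Maximal W (W-wave , no-fwd-ext) = W-wave , λ (U , U-wave , W<U) →
      let open ForwardExtension W W-wave U U-wave W<U in no-fwd-ext (W⁺ , W⁺-wave , W≼fW⁺ , W⁺≉W)

    module TrimmedExtension (sa : StandingAssumptions) (W : PathSet) (W-≤max : LeMaximalWave W)
                            (U : PathSet) (U-wave : IsWave U) (U-trimmed : Trimmed U)
                            (EssW≼U : EssW W ≼ U) where

      open Wave (proj₁ W-≤max) using () renaming (disjoint to W-disjoint; in⊆A to W-in⊆A)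
      open Wave U-wave using () renaming (warp to U-warp; paths to U-paths; disjoint to U-disjoint)

      Ess-ter[W]⊆RF-ter[U] : Ess ter[ W ] ⊆ RF ter[ U ]
      Ess-ter[W]⊆RF-ter[U] s∈Ess@((R , R∈W , tR) , _) =
        V⊆RF-ter U U-wave (proj₁ EssW≼U (R , (R∈W , _ , tR , s∈Ess) , TerIs⇒VOf R tR))

      RF-ter[U]⊆RF-ter[W] : RF ter[ U ] ⊆ RF ter[ W ]
      RF-ter[U]⊆RF-ter[W] with decide (RF ter[ U ] ⊆ RF ter[ W ])
      ... | yes ⊆ = ⊆
      ... | no ⊈ = ⊥-elim (proj₂ W-≤max (U , U-wave , RF-mono-Ess ter[ W ] ter[ U ] Ess-ter[W]⊆RF-ter[U] , ⊈))

      U-ter-Ess : ∀ Q → U Q → ∃ λ t → TerIs Q t × Ess ter[ U ] t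
      U-ter-Ess Q Q∈U with Q′ , (_ , t , tQ′ , t∈Ess) , Q≈Q′ ← proj₁ U-trimmed Q Q∈U =
        t , TerIs-resp-≈ₚ Q′ Q (≈ₚ-sym Q Q′ Q≈Q′) tQ′ , t∈Ess

      U-no-inf : ∀ {f} → ¬ U (inf f)
      U-no-inf Q∈U with U-ter-Ess _ Q∈U
      ... | _ , () , _

      Ess-ter[U]⊆ter[EssW] : Ess ter[ U ] ⊆ ter[ EssW W ]
      Ess-ter[U]⊆ter[EssW] t∈Ess =
        Ess⊆ter[EssW] W (Ess-transfer ter[ W ] ter[ U ] RF-ter[U]⊆RF-ter[W] Ess-ter[W]⊆RF-ter[U] t∈Ess)

      -- An essential path starts in A, where no edge enters, so it starts where the path of U
      -- through its initial vertex does, and then follows that path edge by edge.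
      EssW-prolongs-to-U : ∀ {r rs} → EssW W (fin r rs) → ∃ λ rest → U (fin r (rs ++ rest))
      EssW-prolongs-to-U {r} {rs} R∈EssW with proj₁ EssW≼U (fin r rs , R∈EssW , here refl)
      ... | inf f , Q∈U , _ = ⊥-elim (U-no-inf Q∈U)
      ... | fin q qs , Q∈U , r∈Q
        with unique , linked ← U-paths _ Q∈U
        with refl ← no-in-edge⇒head q qs linked
                      (λ u e → StandingAssumptions.noHeadInA sa u r e (W-in⊆A (_ , proj₁ R∈EssW , refl))) r∈Q
        with rest , refl ← Consec-prefix r qs rs unique
                             (λ c u∈ → E[]-on-path U-warp Q∈U u∈ (proj₂ EssW≼U _ _ (fin r rs , R∈EssW , c)))
        = rest , Q∈U

      prefix-to-ter[U] : ∀ {r rs rest q qs} → U (fin r (rs ++ rest)) → U (fin q qs) →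
                         lastV r rs ≡ lastV q qs → fin r rs ≈ₚ fin q qs
      prefix-to-ter[U] {r} {rs} {rest} {q} {qs} Q′∈U Q∈U t≡
        with refl , refl ← U-disjoint _ _ Q′∈U Q∈U _ (∈-++⁺ˡ (lastV∈ r rs))
                             (subst (_∈ q ∷ qs) (sym t≡) (lastV∈ q qs))
        with refl , _ ← lastV-++-∈-prefix r rs rest (proj₁ (U-paths _ Q∈U)) (lastV∈ r rs) (sym t≡)
        = refl , sym (++-identityʳ rs)

      U⊆EssW : ∀ Q → U Q → ∃ λ R → EssW W R × R ≈ₚ Q
      U⊆EssW (inf f)    Q∈U = ⊥-elim (U-no-inf Q∈U)
      U⊆EssW (fin q qs) Q∈U =
        let t , tQ , t∈Ess = U-ter-Ess (fin q qs) Q∈U in ending-at-ter tQ (Ess-ter[U]⊆ter[EssW] t∈Ess)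
        where
        ending-at-ter : ∀ {t} → lastV q qs ≡ t → ter[ EssW W ] t → ∃ λ R → EssW W R × R ≈ₚ fin q qs
        ending-at-ter refl (fin r rs , R∈EssW , tR) =
          fin r rs , R∈EssW , prefix-to-ter[U] (proj₂ (EssW-prolongs-to-U R∈EssW)) Q∈U tR

      EssW⊆U : ∀ R → EssW W R → ∃ λ Q → U Q × R ≈ₚ Q
      EssW⊆U R@(fin r rs) R∈EssW@(R∈W , _)
        with rest , Q∈U ← EssW-prolongs-to-U R∈EssW
        with R′ , (R′∈W , _) , R′≈Q ← U⊆EssW _ Q∈U
        = _ , Q∈U , ≈ₚ-trans R R′ _ (W-disjoint R R′ R∈W R′∈W r (here refl) r∈R′) R′≈Q
        where
        r∈R′ : VOf R′ r
        r∈R′ = VOf-resp-≈ₚ _ R′ (≈ₚ-sym R′ _ R′≈Q) (here refl)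

      EssW≐U : EssW W ≐ U
      EssW≐U = EssW⊆U , U⊆EssW

    ≤Maximal⇒no-proper-trimmed-extension :
      StandingAssumptions → ∀ W → LeMaximalWave W →
      ¬ (∃ λ U → IsWave U × Trimmed U × EssW W ≼ U × ¬ (EssW W ≐ U))
    ≤Maximal⇒no-proper-trimmed-extension sa W W-≤max (U , U-wave , U-trimmed , EssW≼U , EssW≉U) =
      EssW≉U (TrimmedExtension.EssW≐U sa W W-≤max U U-wave U-trimmed EssW≼U)

lemma3p22 : (lem : ∀ {ℓ} → ExcludedMiddle ℓ)
    → {V : Set} (E : V → V → Set) (A B : Pred V 0ℓ)
    → Web.StandingAssumptions E A B
    → ((W : Web.PathSet E A B) → Web.FwdMaximalWave E A B W → Web.LeMaximalWave E A B W)
    × ((W : Web.PathSet E A B) → Web.MaximalWave E A B W → Web.LeMaximalWave E A B W)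
    × ((W : Web.PathSet E A B) → Web.LeMaximalWave E A B W
        → ¬ (∃ λ U → Web.IsWave E A B U × Web.Trimmed E A B U
               × Web._≼_ E A B (Web.EssW E A B W) U × ¬ (Web._≐_ E A B (Web.EssW E A B W) U)))
lemma3p22 lem E A B sa =
  fwdMaximal⇒≤Maximal E A B lem ,
  (λ W → fwdMaximal⇒≤Maximal E A B lem W ∘ maximal⇒fwdMaximal E A B W) ,
  ≤Maximal⇒no-proper-trimmed-extension E A B lem sa
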